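{- Given a connected graph $G$ and $\Delta\in\mathbb{N}$, one can compute the smallest $\alpha$ such that $(G,\Delta,\alpha)$ is a yes-instance of Stretched Temporal Graph Realization using $\mathcal{O}(\mathrm{diam}(G)\cdot\log(\mathrm{diam}(G)\cdot\Delta))$ calls to a decision oracle for Stretched Temporal Graph Realization.
   Context: A $\Delta$-periodic labeling of a connected graph $G=(V,E)$ is a function $\lambda:E\to\{1,\dots,\Delta\}$; edge $e$ is available exactly at times $\lambda(e)+i\Delta$, $i\ge0$. A temporal path from $s$ to $z$ is a path $s=v_0,\dots,v_k=z$ with distinct vertices and times $t_1<\dots<t_k$ with $\{v_{i-1},v_i\}$ available at $t_i$; its duration is $t_k-t_1+1$. Stretched Temporal Graph Realization: given $G$, $\Delta\in\mathbb{N}$, rational $\alpha\ge1$, decide whether there is a $\Delta$-periodic labeling such that for every ordered pair of distinct vertices $(u,v)$ some temporal path from $u$ to $v$ has duration at most $\alpha\cdot\operatorname{dist}_G(u,v)$. $\mathrm{diam}(G)$ denotes the diameter of $G$. -}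

module Defs where

open import Data.Nat using (ℕ; zero; suc; _+_; _*_; _∸_; _<_; _≤_)
open import Data.Nat.Logarithm using (⌈log₂_⌉)
open import Data.Fin using (Fin; toℕ; inject₁; fromℕ) renaming (zero to fzero; suc to fsuc)
open import Data.Bool using (Bool; true; false)
open import Data.Product using (Σ; ∃; _×_; _,_; proj₁; proj₂)
open import Data.Integer using (+_)
open import Data.Rational using (ℚ; _/_; 1ℚ) renaming (_≤_ to _≤ℚ_; _*_ to _*ℚ_)
open import Relation.Binary.PropositionalEquality using (_≡_; _≢_)
open import Relation.Nullary using (¬_)
open import Function.Definitions using (Injective)
open import Function.Bundles using (_⇔_)

record Graph : Set where
  field
    n      : ℕ
    adj    : Fin n → Fin n → Bool
    sym    : ∀ u v → adj u v ≡ adj v u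
    irrefl : ∀ u → adj u u ≡ false
open Graph public

Adj : (G : Graph) → Fin (n G) → Fin (n G) → Set
Adj G u v = adj G u v ≡ true

record Path (G : Graph) (u v : Fin (n G)) (k : ℕ) : Set where
  field
    w        : Fin (suc k) → Fin (n G)
    start    : w fzero ≡ u
    end      : w (fromℕ k) ≡ v
    edges    : ∀ (i : Fin k) → Adj G (w (inject₁ i)) (w (fsuc i))
    distinct : Injective _≡_ _≡_ w

Connected : Graph → Set
Connected G = ∀ u v → ∃ λ k → Path G u v k

IsDist : (G : Graph) → Fin (n G) → Fin (n G) → ℕ → Set
IsDist G u v d = Path G u v d × (∀ k → Path G u v k → d ≤ k)

IsDiam : Graph → ℕ → Set
IsDiam G D = (∀ u v d → IsDist G u v d → d ≤ D)
           × (∃ λ u → ∃ λ v → IsDist G u v D)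

record Labeling (G : Graph) (Δ : ℕ) : Set where
  field
    lab    : Fin (n G) → Fin (n G) → ℕ
    labSym : ∀ u v → Adj G u v → lab u v ≡ lab v u
    labPos : ∀ u v → Adj G u v → 1 ≤ lab u v
    labLe  : ∀ u v → Adj G u v → lab u v ≤ Δ
open Labeling public

Available : (G : Graph) (Δ : ℕ) → Labeling G Δ → Fin (n G) → Fin (n G) → ℕ → Set
Available G Δ L x y t = ∃ λ i → t ≡ lab L x y + i * Δ

-- a temporal path from u to v with k+1 edges (vertex distinctness included in Path)
record TemporalPath (G : Graph) (Δ : ℕ) (L : Labeling G Δ) (u v : Fin (n G)) (k : ℕ) : Set where
  field
    path   : Path G u v (suc k)
    time   : Fin (suc k) → ℕ
    incr   : ∀ i j → toℕ i < toℕ j → time i < time j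
    avail  : ∀ i → Available G Δ L (Path.w path (inject₁ i)) (Path.w path (fsuc i)) (time i)

duration : ∀ {G Δ L u v k} → TemporalPath G Δ L u v k → ℕ
duration {k = k} P = TemporalPath.time P (fromℕ k) ∸ TemporalPath.time P fzero + 1

ℕtoℚ : ℕ → ℚ
ℕtoℚ m = + m / 1

YesInstance : (G : Graph) → ℕ → ℚ → Set
YesInstance G Δ α =
  Σ (Labeling G Δ) λ L →
    ∀ u v → u ≢ v → ∀ d → IsDist G u v d →
      ∃ λ k → Σ (TemporalPath G Δ L u v k) λ P →
        ℕtoℚ (duration P) ≤ℚ (α *ℚ ℕtoℚ d)

IsSmallestStretch : Graph → ℕ → ℚ → Set
IsSmallestStretch G Δ α =
  1ℚ ≤ℚ α × YesInstance G Δ α × (∀ β → 1ℚ ≤ℚ β → YesInstance G Δ β → α ≤ℚ β)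

-- adaptive oracle algorithms: decision trees whose internal nodes query the
-- decision oracle on a value α and branch on the Boolean answer
data QTree : Set where
  ret : ℚ → QTree
  ask : ℚ → (Bool → QTree) → QTree

result : (ℚ → Bool) → QTree → ℚ
result O (ret q)   = q
result O (ask α k) = result O (k (O α))

calls : (ℚ → Bool) → QTree → ℕ
calls O (ret q)   = 0
calls O (ask α k) = suc (calls O (k (O α)))

CorrectOracle : Graph → ℕ → (ℚ → Bool) → Set
CorrectOracle G Δ O = ∀ α → 1ℚ ≤ℚ α → (O α ≡ true) ⇔ YesInstance G Δ α

{-# OPTIONS --safe #-}
-- Every constraint of Stretched Temporal Graph Realization compares an integral
-- duration with α · d for a distance 1 ≤ d ≤ D, and d divides D!.  Hence if some
-- β < (m+1)/D! is realizable then so is m/D!: the least stretch lies on the grid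
-- (1/D!)ℕ, and it is the grid point just above the last infeasible one.  Labelling
-- every edge 1 realizes α = Δ, and Δ · D! ≤ (DΔ)^D ≤ 2^(D⌈log₂(DΔ)⌉), so a binary
-- search over an interval of 2^(D(1+⌈log₂(DΔ)⌉)) grid points finds it with
-- D(1+⌈log₂(DΔ)⌉) oracle calls.
module Submission where

open import Defs
open import Data.Nat using (ℕ; _+_; _*_; _≤_; NonZero)
open import Data.Nat.Logarithm using (⌈log₂_⌉)
open import Data.Product using (Σ; ∃; _×_)
open import Data.Bool using (Bool)
open import Data.Rational using (ℚ)

open import Data.Bool using (true; false; if_then_else_)
open import Data.Empty using (⊥-elim)
open import Data.Fin using (toℕ; fromℕ)
open import Data.Fin.Properties using (toℕ-fromℕ)
open import Data.Integer as ℤ using (+_)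
open import Data.Integer.Properties using (pos-*; drop‿+≤+)
open import Data.Nat using (zero; suc; pred; _<_; _^_; _!; z≤n; s≤s; s≤s⁻¹; ⌈_/2⌉; >-nonZero⁻¹)
open import Data.Nat.Divisibility using (_∣_; divides; 1∣_; ∣-trans; m∣m*n; ∣n⇒∣m*n; m≤n⇒m!∣n!)
open import Data.Nat.Induction using (<-wellFounded)
open import Data.Nat.Logarithm.Core using (⌈log2⌉)
import Data.Nat.Properties as ℕ
open import Data.Nat.Solver using (module +-*-Solver)
open import Data.Product using (_,_; proj₁)
open import Data.Rational using (_/_; 1ℚ; toℚᵘ)
  renaming (_≤_ to _≤ℚ_; _<_ to _<ℚ_; _*_ to _*ℚ_)
import Data.Rational.Properties as ℚ
open import Data.Rational.Unnormalised as ℚᵘ using (mkℚᵘ; *≤*; *≡*) renaming (_≃_ to _≃ᵘ_)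
import Data.Rational.Unnormalised.Properties as ℚᵘ
open import Function.Bundles using (_⇔_; mk⇔; Equivalence)
open import Induction.WellFounded using (Acc; acc)
open import Relation.Binary.PropositionalEquality
  using (_≡_; _≢_; refl; trans; cong; subst; subst₂; cong₂) renaming (sym to ≡-sym)
open import Relation.Nullary using (¬_; yes; no)

open Equivalence using (to; from)

n≤2^⌈log2⌉n : ∀ n (rec : Acc _<_ n) → n ≤ 2 ^ ⌈log2⌉ n rec
n≤2^⌈log2⌉n zero          _        = z≤n
n≤2^⌈log2⌉n (suc zero)    _        = s≤s z≤n
n≤2^⌈log2⌉n (suc (suc n)) (acc rs) = begin
  suc (suc n)              ≤⟨ s≤s (s≤s n≤2*h) ⟩
  2 + 2 * h                ≡⟨ ≡-sym (ℕ.*-suc 2 h) ⟩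
  2 * suc h                ≤⟨ ℕ.*-monoʳ-≤ 2 (n≤2^⌈log2⌉n (suc h) (rs (ℕ.⌈n/2⌉<n n))) ⟩
  2 * 2 ^ ⌈log2⌉ (suc h) _ ∎
  where
  open ℕ.≤-Reasoning
  h = ⌈ n /2⌉
  n≤2*h : n ≤ 2 * h
  n≤2*h = subst (_≤ 2 * h) (ℕ.⌊n/2⌋+⌈n/2⌉≡n n) (ℕ.+-mono-≤ (ℕ.⌊n/2⌋≤⌈n/2⌉ n) (ℕ.m≤m+n h 0))

n≤2^⌈log₂n⌉ : ∀ n → n ≤ 2 ^ ⌈log₂ n ⌉
n≤2^⌈log₂n⌉ n = n≤2^⌈log2⌉n n (<-wellFounded n)

n!≤n^n : ∀ n → n ! ≤ n ^ n
n!≤n^n zero    = ℕ.≤-refl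
n!≤n^n (suc n) = ℕ.*-monoʳ-≤ (suc n) (ℕ.≤-trans (n!≤n^n n) (ℕ.^-monoˡ-≤ n (ℕ.n≤1+n n)))

m≤m^n : ∀ m n .{{_ : NonZero m}} .{{_ : NonZero n}} → m ≤ m ^ n
m≤m^n m (suc n) = subst (_≤ m * m ^ n) (ℕ.*-identityʳ m) (ℕ.*-monoʳ-≤ m (ℕ.m^n>0 m n))

^-distribʳ-* : ∀ m n k → (m * n) ^ k ≡ m ^ k * n ^ k
^-distribʳ-* m n zero    = refl
^-distribʳ-* m n (suc k) rewrite ^-distribʳ-* m n k =
  solve 4 (λ m n x y → (m :* n) :* (x :* y) := (m :* x) :* (n :* y)) refl m n (m ^ k) (n ^ k)
  where open +-*-Solver

*-!≤2^*⌈log₂*⌉ : ∀ n Δ .{{_ : NonZero n}} .{{_ : NonZero Δ}} → Δ * n ! ≤ 2 ^ (n * ⌈log₂ (n * Δ) ⌉)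
*-!≤2^*⌈log₂*⌉ n Δ = begin
  Δ * n !         ≤⟨ ℕ.*-mono-≤ (m≤m^n Δ n) (n!≤n^n n) ⟩
  Δ ^ n * n ^ n   ≡⟨ ℕ.*-comm (Δ ^ n) (n ^ n) ⟩
  n ^ n * Δ ^ n   ≡⟨ ≡-sym (^-distribʳ-* n Δ n) ⟩
  (n * Δ) ^ n     ≤⟨ ℕ.^-monoˡ-≤ n (n≤2^⌈log₂n⌉ (n * Δ)) ⟩
  (2 ^ L) ^ n     ≡⟨ ℕ.^-*-assoc 2 L n ⟩
  2 ^ (L * n)     ≡⟨ cong (2 ^_) (ℕ.*-comm L n) ⟩
  2 ^ (n * L)     ∎
  where
  open ℕ.≤-Reasoning
  L = ⌈log₂ (n * Δ) ⌉

n<[1+m]*d⇒n≤m*d : ∀ {n m d} → d ∣ n → n < suc m * d → n ≤ m * d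
n<[1+m]*d⇒n≤m*d {m = m} {d} (divides q refl) q*d<[1+m]*d =
  ℕ.*-monoˡ-≤ d (s≤s⁻¹ (ℕ.*-cancelʳ-< d q (suc m) q*d<[1+m]*d))

m≤n⇒m<n+2^k : ∀ {m n} k → m ≤ n → m < n + 2 ^ k
m≤n⇒m<n+2^k {n = n} k m≤n = ℕ.≤-<-trans m≤n (ℕ.m<m+n n (ℕ.m^n>0 2 k))

n≤m⇒n∣m! : ∀ {n m} .{{_ : NonZero n}} → n ≤ m → n ∣ m !
n≤m⇒n∣m! {suc n} 1+n≤m = ∣-trans (m∣m*n (n !)) (m≤n⇒m!∣n! 1+n≤m)

module Bisection (f : ℕ → ℚ) where

  bisect : ℕ → ℕ → QTree
  bisect zero    lo = ret (f (suc lo))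
  bisect (suc j) lo = ask (f (lo + 2 ^ j)) λ b → if b then bisect j lo else bisect j (lo + 2 ^ j)

  calls-bisect : ∀ O j lo → calls O (bisect j lo) ≡ j
  calls-bisect O zero    lo = refl
  calls-bisect O (suc j) lo with O (f (lo + 2 ^ j))
  ... | true  = cong suc (calls-bisect O j lo)
  ... | false = cong suc (calls-bisect O j (lo + 2 ^ j))

  module _ {P : ℕ → Set} {O : ℚ → Bool} {lo₀ : ℕ}
           (O-decides : ∀ k → lo₀ < k → (O (f k) ≡ true) ⇔ P k) where

    O-decides-midpoint : ∀ j {lo} → lo₀ ≤ lo → (O (f (lo + 2 ^ j)) ≡ true) ⇔ P (lo + 2 ^ j)
    O-decides-midpoint j lo₀≤lo = O-decides _ (m≤n⇒m<n+2^k j lo₀≤lo)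

    result-bisect : ∀ j lo → lo₀ ≤ lo → ¬ P lo → P (lo + 2 ^ j) →
      ∃ λ m → ¬ P m × P (suc m) × result O (bisect j lo) ≡ f (suc m)
    result-bisect zero    lo _      ¬Plo Plo+1 = lo , ¬Plo , subst P (ℕ.+-comm lo 1) Plo+1 , refl
    result-bisect (suc j) lo lo₀≤lo ¬Plo Ptop with O (f (lo + 2 ^ j)) in answer
    ... | true  = result-bisect j lo lo₀≤lo ¬Plo (to (O-decides-midpoint j lo₀≤lo) answer)
    ... | false = result-bisect j (lo + 2 ^ j) (ℕ.≤-trans lo₀≤lo (ℕ.m≤m+n lo _)) ¬Pmid (subst P halves Ptop)
      where
      ¬Pmid : ¬ P (lo + 2 ^ j)
      ¬Pmid Pmid with () ← trans (≡-sym answer) (from (O-decides-midpoint j lo₀≤lo) Pmid)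
      halves : lo + 2 ^ suc j ≡ lo + 2 ^ j + 2 ^ j
      halves = solve 2 (λ lo x → lo :+ con 2 :* x := (lo :+ x) :+ x) refl lo (2 ^ j)
        where open +-*-Solver

open Bisection using (bisect; calls-bisect; result-bisect)

toℚᵘ-/ : ∀ a n .{{_ : NonZero n}} → toℚᵘ (+ a / n) ≃ᵘ mkℚᵘ (+ a) (pred n)
toℚᵘ-/ a (suc n) = ℚ.toℚᵘ-fromℚᵘ (mkℚᵘ (+ a) n)

/≤/⇔*≤* : ∀ a m b n .{{_ : NonZero m}} .{{_ : NonZero n}} → (+ a / m ≤ℚ + b / n) ⇔ (a * n ≤ b * m)
/≤/⇔*≤* a m@(suc _) b n@(suc _) = mk⇔ cross-multiply cross-divide
  where
  cross-multiply : + a / m ≤ℚ + b / n → a * n ≤ b * m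
  cross-multiply a/m≤b/n
    with ℚᵘ.≤-respʳ-≃ (toℚᵘ-/ b n) (ℚᵘ.≤-respˡ-≃ (toℚᵘ-/ a m) (ℚ.toℚᵘ-mono-≤ a/m≤b/n))
  ... | *≤* an≤bm = drop‿+≤+ (subst₂ ℤ._≤_ (≡-sym (pos-* a n)) (≡-sym (pos-* b m)) an≤bm)

  cross-divide : a * n ≤ b * m → + a / m ≤ℚ + b / n
  cross-divide an≤bm = ℚ.toℚᵘ-cancel-≤ (begin
    toℚᵘ (+ a / m)      ≃⟨ toℚᵘ-/ a m ⟩
    mkℚᵘ (+ a) (pred m) ≤⟨ *≤* (subst₂ ℤ._≤_ (pos-* a n) (pos-* b m) (ℤ.+≤+ an≤bm)) ⟩
    mkℚᵘ (+ b) (pred n) ≃⟨ ℚᵘ.≃-sym (toℚᵘ-/ b n) ⟩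
    toℚᵘ (+ b / n)      ∎)
    where open ℚᵘ.≤-Reasoning

1≤/⇔≤ : ∀ a n .{{_ : NonZero n}} → (1ℚ ≤ℚ + a / n) ⇔ (n ≤ a)
1≤/⇔≤ a n = subst₂ (λ x y → (1ℚ ≤ℚ + a / n) ⇔ (x ≤ y)) (ℕ.*-identityˡ n) (ℕ.*-identityʳ a)
  (/≤/⇔*≤* 1 1 a n)

/*ℕtoℚ : ∀ a n d .{{_ : NonZero n}} → (+ a / n) *ℚ ℕtoℚ d ≡ + (a * d) / n
/*ℕtoℚ a n@(suc n-1) d = ℚ.toℚᵘ-injective (begin
  toℚᵘ ((+ a / n) *ℚ ℕtoℚ d)        ≈⟨ ℚ.toℚᵘ-homo-* (+ a / n) (ℕtoℚ d) ⟩
  toℚᵘ (+ a / n) ℚᵘ.* toℚᵘ (ℕtoℚ d) ≈⟨ ℚᵘ.*-cong (toℚᵘ-/ a n) (toℚᵘ-/ d 1) ⟩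
  mkℚᵘ (+ a) n-1 ℚᵘ.* mkℚᵘ (+ d) 0  ≈⟨ *≡* cross-products ⟩
  mkℚᵘ (+ (a * d)) n-1               ≈⟨ ℚᵘ.≃-sym (toℚᵘ-/ (a * d) n) ⟩
  toℚᵘ (+ (a * d) / n)               ∎)
  where
  open ℚᵘ.≃-Reasoning
  cross-products : (+ a ℤ.* + d) ℤ.* + n ≡ + (a * d) ℤ.* + suc (n-1 * 1)
  cross-products = cong₂ ℤ._*_ (≡-sym (pos-* a d)) (cong (λ k → + suc k) (≡-sym (ℕ.*-identityʳ n-1)))

ℕtoℚ≤/*ℕtoℚ : ∀ t a n d .{{_ : NonZero n}} → t * n ≤ a * d → ℕtoℚ t ≤ℚ (+ a / n) *ℚ ℕtoℚ d
ℕtoℚ≤/*ℕtoℚ t a n d tn≤ad = subst (ℕtoℚ t ≤ℚ_) (≡-sym (/*ℕtoℚ a n d))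
  (from (/≤/⇔*≤* t 1 (a * d) n) (subst (t * n ≤_) (≡-sym (ℕ.*-identityʳ (a * d))) tn≤ad))

/*ℕtoℚ≤ℕtoℚ : ∀ t a n d .{{_ : NonZero n}} → a * d ≤ t * n → (+ a / n) *ℚ ℕtoℚ d ≤ℚ ℕtoℚ t
/*ℕtoℚ≤ℕtoℚ t a n d ad≤tn = subst (_≤ℚ ℕtoℚ t) (≡-sym (/*ℕtoℚ a n d))
  (from (/≤/⇔*≤* (a * d) n t 1) (subst (_≤ t * n) (≡-sym (ℕ.*-identityʳ (a * d))) ad≤tn))

stretch-round-down : ∀ t m {d N β} .{{_ : NonZero d}} .{{_ : NonZero N}} → d ∣ N →
  ℕtoℚ t ≤ℚ β *ℚ ℕtoℚ d → β <ℚ + suc m / N → ℕtoℚ t ≤ℚ (+ m / N) *ℚ ℕtoℚ d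
stretch-round-down t m {d} {N} {β} d∣N t≤βd β<[1+m]/N =
  ℕtoℚ≤/*ℕtoℚ t m N d (n<[1+m]*d⇒n≤m*d {m = m} (∣n⇒∣m*n t d∣N) (ℕ.≰⇒> [1+m]*d≰t*N))
  where
  [1+m]*d≰t*N : ¬ (suc m * d ≤ t * N)
  [1+m]*d≰t*N [1+m]*d≤t*N = ℚ.<-irrefl refl (begin-strict
    (+ suc m / N) *ℚ ℕtoℚ d ≤⟨ /*ℕtoℚ≤ℕtoℚ t (suc m) N d [1+m]*d≤t*N ⟩
    ℕtoℚ t                  ≤⟨ t≤βd ⟩
    β *ℚ ℕtoℚ d             <⟨ ℚ.*-monoˡ-<-pos (ℕtoℚ d) {{ℚ.normalize-pos d 1}} β<[1+m]/N ⟩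
    (+ suc m / N) *ℚ ℕtoℚ d ∎)
    where open ℚ.≤-Reasoning

Path-zero⇒≡ : ∀ {G u v} → Path G u v 0 → u ≡ v
Path-zero⇒≡ P = trans (≡-sym (Path.start P)) (Path.end P)

≢⇒dist≢0 : ∀ {G u v d} → u ≢ v → IsDist G u v d → NonZero d
≢⇒dist≢0 {d = zero}  u≢v (P , _) = ⊥-elim (u≢v (Path-zero⇒≡ P))
≢⇒dist≢0 {d = suc _} _   _       = _

DistancesDivide : Graph → ℕ → Set
DistancesDivide G N = ∀ {u v d} → u ≢ v → IsDist G u v d → d ∣ N

IsDiam⇒DistancesDivide! : ∀ {G D} → IsDiam G D → DistancesDivide G (D !)
IsDiam⇒DistancesDivide! (bounded , _) {u} {v} {d} u≢v dist =
  n≤m⇒n∣m! {{≢⇒dist≢0 u≢v dist}} (bounded u v d dist)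

uniformLabeling : ∀ G Δ .{{_ : NonZero Δ}} → Labeling G Δ
uniformLabeling G Δ = record
  { lab    = λ _ _ → 1
  ; labSym = λ _ _ _ → refl
  ; labPos = λ _ _ _ → ℕ.≤-refl
  ; labLe  = λ _ _ _ → >-nonZero⁻¹ Δ
  }

YesInstance-Δ : ∀ G Δ .{{_ : NonZero Δ}} → YesInstance G Δ (ℕtoℚ Δ)
YesInstance-Δ G Δ = uniformLabeling G Δ , realize
  where
  realize : ∀ u v → u ≢ v → ∀ d → IsDist G u v d →
    ∃ λ k → Σ (TemporalPath G Δ (uniformLabeling G Δ) u v k) λ P →
      ℕtoℚ (duration P) ≤ℚ ℕtoℚ Δ *ℚ ℕtoℚ d
  realize u v u≢v zero    (P , _) = ⊥-elim (u≢v (Path-zero⇒≡ P))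
  realize u v _   (suc k) (P , _) = k , P′ , ℕtoℚ≤/*ℕtoℚ (duration P′) Δ 1 (suc k) stretch
    where
    P′ : TemporalPath G Δ (uniformLabeling G Δ) u v k
    P′ = record
      { path  = P
      ; time  = λ i → 1 + toℕ i * Δ
      ; incr  = λ i j i<j → s≤s (ℕ.*-monoˡ-< Δ i<j)
      ; avail = λ i → toℕ i , refl
      }
    stretch : duration P′ * 1 ≤ Δ * suc k
    stretch = begin
      (toℕ (fromℕ k) * Δ + 1) * 1 ≡⟨ ℕ.*-identityʳ _ ⟩
      toℕ (fromℕ k) * Δ + 1       ≡⟨ cong (λ i → i * Δ + 1) (toℕ-fromℕ k) ⟩
      k * Δ + 1                   ≤⟨ ℕ.+-monoʳ-≤ (k * Δ) (>-nonZero⁻¹ Δ) ⟩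
      k * Δ + Δ                   ≡⟨ ℕ.+-comm (k * Δ) Δ ⟩
      suc k * Δ                   ≡⟨ ℕ.*-comm (suc k) Δ ⟩
      Δ * suc k                   ∎
      where open ℕ.≤-Reasoning

IsDiam-zero⇒YesInstance : ∀ {G} Δ .{{_ : NonZero Δ}} → IsDiam G 0 → ∀ α → YesInstance G Δ α
IsDiam-zero⇒YesInstance {G} Δ (bounded , _) α = uniformLabeling G Δ , λ u v u≢v d dist →
  ⊥-elim (u≢v (Path-zero⇒≡ (proj₁ (subst (IsDist G u v) (ℕ.n≤0⇒n≡0 (bounded u v d dist)) dist))))

YesInstance-mono : ∀ {G Δ α β} → α ≤ℚ β → YesInstance G Δ α → YesInstance G Δ β
YesInstance-mono α≤β (L , realize) = L , λ u v u≢v d dist →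
  let (k , P , dur≤αd) = realize u v u≢v d dist
  in  k , P , ℚ.≤-trans dur≤αd (ℚ.*-monoʳ-≤-nonNeg (ℕtoℚ d) {{ℚ.normalize-nonNeg d 1}} α≤β)

YesInstance-round-down : ∀ {G Δ N m β} .{{_ : NonZero N}} → DistancesDivide G N →
  YesInstance G Δ β → β <ℚ + suc m / N → YesInstance G Δ (+ m / N)
YesInstance-round-down {m = m} d∣N (L , realize) β<[1+m]/N = L , λ u v u≢v d dist →
  let (k , P , dur≤βd) = realize u v u≢v d dist
  in  k , P , stretch-round-down (duration P) m {{≢⇒dist≢0 u≢v dist}} (d∣N u≢v dist) dur≤βd β<[1+m]/N

Feasible : Graph → ℕ → ℚ → Set
Feasible G Δ α = 1ℚ ≤ℚ α × YesInstance G Δ α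

Feasible-mono : ∀ {G Δ α β} → α ≤ℚ β → Feasible G Δ α → Feasible G Δ β
Feasible-mono α≤β (1≤α , yesα) = ℚ.≤-trans 1≤α α≤β , YesInstance-mono α≤β yesα

-- The constraint 1 ≤ β is itself a stretch bound, for a pair of duration and distance 1.
Feasible-round-down : ∀ {G Δ N m β} .{{_ : NonZero N}} → DistancesDivide G N →
  Feasible G Δ β → β <ℚ + suc m / N → Feasible G Δ (+ m / N)
Feasible-round-down {N = N} {m} {β} d∣N (1≤β , yesβ) β<[1+m]/N =
  subst (1ℚ ≤ℚ_) (ℚ.*-identityʳ (+ m / N))
    (stretch-round-down 1 m (1∣ N) (subst (1ℚ ≤ℚ_) (≡-sym (ℚ.*-identityʳ β)) 1≤β) β<[1+m]/N)
  , YesInstance-round-down d∣N yesβ β<[1+m]/N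

boundary⇒IsSmallestStretch : ∀ {G Δ N m} .{{_ : NonZero N}} → DistancesDivide G N →
  ¬ Feasible G Δ (+ m / N) → Feasible G Δ (+ suc m / N) → IsSmallestStretch G Δ (+ suc m / N)
boundary⇒IsSmallestStretch {G} {Δ} {N} {m} d∣N ¬feasible (1≤ , yes[1+m]) = 1≤ , yes[1+m] , least
  where
  least : ∀ β → 1ℚ ≤ℚ β → YesInstance G Δ β → + suc m / N ≤ℚ β
  least β 1≤β yesβ with + suc m / N ℚ.≤? β
  ... | yes ≤β = ≤β
  ... | no  ≰β = ⊥-elim (¬feasible (Feasible-round-down d∣N (1≤β , yesβ) (ℚ.≰⇒> ≰β)))

searchDepth : ℕ → ℕ → ℕ
searchDepth D Δ = D * (1 + ⌈log₂ (D * Δ) ⌉)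

Feasible-above-Δ : ∀ {G Δ N K} .{{_ : NonZero N}} .{{_ : NonZero Δ}} →
  Δ * N ≤ K → Feasible G Δ (+ K / N)
Feasible-above-Δ {G} {Δ} {N} {K} ΔN≤K =
  Feasible-mono {α = ℕtoℚ Δ} Δ≤K/N (from (1≤/⇔≤ Δ 1) (>-nonZero⁻¹ Δ) , YesInstance-Δ G Δ)
  where
  Δ≤K/N : ℕtoℚ Δ ≤ℚ + K / N
  Δ≤K/N = from (/≤/⇔*≤* Δ 1 K N) (subst (Δ * N ≤_) (≡-sym (ℕ.*-identityʳ K)) ΔN≤K)

Feasible-top : ∀ {G} Δ .{{_ : NonZero Δ}} D → IsDiam G D →
  Feasible G Δ ((+ (pred (D !) + 2 ^ searchDepth D Δ) / D !) {{D ℕ.!≢0}})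
Feasible-top Δ zero    diam = ℚ.≤-refl , IsDiam-zero⇒YesInstance Δ diam 1ℚ
Feasible-top Δ (suc n) _    = Feasible-above-Δ {{suc n ℕ.!≢0}} (begin
  Δ * suc n !                ≤⟨ *-!≤2^*⌈log₂*⌉ (suc n) Δ ⟩
  2 ^ (suc n * L)            ≤⟨ ℕ.^-monoʳ-≤ 2 (ℕ.*-monoʳ-≤ (suc n) (ℕ.n≤1+n L)) ⟩
  2 ^ searchDepth (suc n) Δ  ≤⟨ ℕ.m≤n+m _ (pred (suc n !)) ⟩
  pred (suc n !) + 2 ^ searchDepth (suc n) Δ ∎)
  where
  open ℕ.≤-Reasoning
  L = ⌈log₂ (suc n * Δ) ⌉

gridSearch : (N : ℕ) .{{_ : NonZero N}} → ℕ → QTree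
gridSearch N j = bisect (λ k → + k / N) j (pred N)

CorrectOracle⇒decides-Feasible : ∀ {G Δ O α} → CorrectOracle G Δ O → 1ℚ ≤ℚ α →
  (O α ≡ true) ⇔ Feasible G Δ α
CorrectOracle⇒decides-Feasible {α = α} correct 1≤α =
  mk⇔ (λ accepted → 1≤α , to (correct α 1≤α) accepted) (λ (_ , yesα) → from (correct α 1≤α) yesα)

gridSearch-correct : ∀ {G Δ O} N .{{_ : NonZero N}} j → DistancesDivide G N → CorrectOracle G Δ O →
  Feasible G Δ (+ (pred N + 2 ^ j) / N) → IsSmallestStretch G Δ (result O (gridSearch N j))
gridSearch-correct {G} {Δ} {O} N j d∣N correct feasible-top =
  let (m , ¬Fm , F[1+m] , result≡) =
        result-bisect (λ k → + k / N) decides j (pred N) ℕ.≤-refl ¬F[N-1] feasible-top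
  in  subst (IsSmallestStretch G Δ) (≡-sym result≡) (boundary⇒IsSmallestStretch d∣N ¬Fm F[1+m])
  where
  decides : ∀ k → pred N < k → (O (+ k / N) ≡ true) ⇔ Feasible G Δ (+ k / N)
  decides k pred[N]<k =
    CorrectOracle⇒decides-Feasible correct (from (1≤/⇔≤ k N) (subst (_≤ k) (ℕ.suc-pred N) pred[N]<k))
  ¬F[N-1] : ¬ Feasible G Δ (+ pred N / N)
  ¬F[N-1] (1≤ , _) =
    ℕ.<-irrefl refl (subst (_≤ pred N) (≡-sym (ℕ.suc-pred N)) (to (1≤/⇔≤ (pred N) N) 1≤))

stretchSearch : ℕ → ℕ → QTree
stretchSearch D Δ = gridSearch (D !) {{D ℕ.!≢0}} (searchDepth D Δ)

mainTheorem15 : ∃ λ (c : ℕ) → Σ (ℕ → ℕ → QTree) λ A →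
    ∀ (G : Graph) (Δ : ℕ) → NonZero Δ → Connected G → ∀ (D : ℕ) → IsDiam G D →
      ∀ (O : ℚ → Bool) → CorrectOracle G Δ O →
        IsSmallestStretch G Δ (result O (A D Δ))
        × calls O (A D Δ) ≤ c * (D * (1 + ⌈log₂ (D * Δ) ⌉))
mainTheorem15 = 1 , stretchSearch , λ G Δ Δ≢0 _ D diam O correct →
    gridSearch-correct (D !) {{D ℕ.!≢0}} (searchDepth D Δ)
      (IsDiam⇒DistancesDivide! diam) correct (Feasible-top Δ {{Δ≢0}} D diam)
  , ℕ.≤-reflexive (trans (calls-bisect _ O (searchDepth D Δ) _) (≡-sym (ℕ.*-identityˡ _)))
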